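{- Let $n$ be a positive integer and let $L=\{1^{a_1},2^{a_2},\ldots,n^{a_n}\}$ where $a_i\geq 0$ for every $i\in[1,n]$. If there is a perfect matching $F$ of $K_{2n}$ such that $\ell(F)=L$, then $\sum_{i=1}^{\lfloor n/2\rfloor} a_{2i}$ is even.
   Context: For a positive integer $v$, $K_v$ denotes the complete graph on the vertex set $\{0,1,\ldots,v-1\}$. The length of an edge $\{u,w\}$ of $K_v$ is $\ell(u,w)=\min(|u-w|,\,v-|u-w|)$. For a subgraph $\Gamma$ of $K_v$, $\ell(\Gamma)$ is the list (multiset) of lengths of all edges of $\Gamma$, counted with multiplicity. A perfect matching of $K_{2n}$ is a set of $n$ pairwise disjoint edges covering all vertices. The notation $\{1^{a_1},\ldots,n^{a_n}\}$ denotes the list containing $a_i$ copies of $i$ for each $i$; $[a,b]$ denotes the set of integers $a,a+1,\ldots,b$. -}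

module Defs where

open import Data.Nat using (ℕ; zero; suc; _+_; _*_; _∸_; _⊓_; _≤?_; _/_)
open import Data.Fin using (Fin; toℕ)
open import Data.List using (List; []; _∷_; map; concatMap; replicate; allFin; length; upTo; applyUpTo)
open import Data.Product using (_×_; _,_; proj₁; proj₂)
open import Data.List.Relation.Binary.Permutation.Propositional using (_↭_)
open import Relation.Binary.PropositionalEquality using (_≡_)
open import Relation.Nullary.Decidable using (does)
open import Data.Bool using (if_then_else_)
open import Data.Nat.ListAction using (sum)

-- An edge of K_v, given by its two endpoints (order irrelevant for its length).
Edge : ℕ → Set
Edge v = Fin v × Fin v

absDiff : ℕ → ℕ → ℕ
absDiff u w = (u ∸ w) + (w ∸ u)

edgeLength : (v : ℕ) → Edge v → ℕ
edgeLength v (u , w) = absDiff (toℕ u) (toℕ w) ⊓ (v ∸ absDiff (toℕ u) (toℕ w))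

lengths : (v : ℕ) → List (Edge v) → List ℕ
lengths v F = map (edgeLength v) F

endpoints : {v : ℕ} → List (Edge v) → List (Fin v)
endpoints F = concatMap (λ e → proj₁ e ∷ proj₂ e ∷ []) F

-- A perfect matching of K_{2n}: a set of n edges, pairwise disjoint and covering
-- every vertex. Equivalently as data: the multiset of endpoints is exactly the
-- vertex set (each vertex appears exactly once), which forces u ≠ w in each edge,
-- pairwise disjointness, coverage, and exactly n edges.
IsPerfectMatching : (n : ℕ) → List (Edge (2 * n)) → Set
IsPerfectMatching n F = endpoints F ↭ allFin (2 * n)

lengthList : (n : ℕ) → (ℕ → ℕ) → List ℕ
lengthList n a = concatMap (λ i → replicate (a i) i) (applyUpTo suc n)

evenIndexSum : (n : ℕ) → (ℕ → ℕ) → ℕ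
evenIndexSum n a = sum (map (λ i → a (2 * i)) (applyUpTo suc (n / 2)))

-- Since 2n is even, an edge {u, w} of K_{2n} has length min(d, 2n - d) ≡ d ≡ u + w (mod 2),
-- where d = |u - w|. Summing over a perfect matching F, whose endpoints are every vertex
-- exactly once, the total length is ≡ 0 + 1 + ... + (2n - 1) = n(2n - 1) ≡ n (mod 2).
-- So ≡ n of the n edges have odd length, and an even number have even length;
-- and the number of even entries of {1^{a_1}, ..., n^{a_n}} is a_2 + a_4 + ... .
module Submission where

open import Defs
open import Data.Nat using (ℕ; zero; suc; _+_; _*_; _<_; _≤_; _∸_; _⊓_; _/_; parity; z≤n; s≤s)
open import Data.Nat.Properties
  using (+-assoc; +-comm; +-identityʳ; +-suc; *-suc; *-zeroʳ; *-identityʳ; *-cancelˡ-≡;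
         ⊓-sel; m∸n+n≡m; <⇒≤)
open import Data.Nat.DivMod using (m/n≡1+[m∸n]/n)
open import Data.Nat.Divisibility using (_∣_; divides)
open import Data.Nat.ListAction using (sum)
open import Data.Nat.ListAction.Properties using (sum-++; sum-↭)
open import Data.Parity.Base as ℙ using (0ℙ)
import Data.Parity.Properties as ℙ
open import Data.Fin using (toℕ)
open import Data.Fin.Properties using (toℕ<n)
open import Data.List
  using (List; []; _∷_; _++_; _∷ʳ_; map; concatMap; replicate; allFin; length; tabulate;
         applyUpTo; upTo)
open import Data.List.Properties
  using (map-++; length-map; map-tabulate; length-tabulate; map-applyUpTo; upTo-∷ʳ)
open import Data.List.Relation.Binary.Permutation.Propositional using (_↭_)
open import Data.List.Relation.Binary.Permutation.Propositional.Properties using (map⁺; ↭-length)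
open import Data.Product using (Σ; _×_; _,_)
open import Data.Sum using (inj₁; inj₂)
open import Function using (_∘_; id)
open import Relation.Binary.PropositionalEquality using (_≡_; refl; sym; trans; cong; cong₂; subst)
open Relation.Binary.PropositionalEquality.≡-Reasoning

parity≡0ℙ⇒2∣ : ∀ m → parity m ≡ 0ℙ → 2 ∣ m
parity≡0ℙ⇒2∣ zero          _  = divides 0 refl
parity≡0ℙ⇒2∣ (suc zero)    ()
parity≡0ℙ⇒2∣ (suc (suc m)) eq with parity≡0ℙ⇒2∣ m eq
... | divides q m≡q*2 = divides (suc q) (cong (suc ∘ suc) m≡q*2)

parity-∸ : ∀ {m n} → n ≤ m → parity (m ∸ n) ≡ parity m ℙ.+ parity n
parity-∸ {m} {n} n≤m = ℙ.+-cancelʳ-≡ (parity n) _ _ (begin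
  parity (m ∸ n) ℙ.+ parity n           ≡⟨ ℙ.+-homo-+ (m ∸ n) n ⟨
  parity (m ∸ n + n)                    ≡⟨ cong parity (m∸n+n≡m n≤m) ⟩
  parity m                              ≡⟨ ℙ.+-identityʳ (parity m) ⟨
  parity m ℙ.+ 0ℙ                       ≡⟨ cong (parity m ℙ.+_) (ℙ.p+p≡0ℙ (parity n)) ⟨
  parity m ℙ.+ (parity n ℙ.+ parity n)  ≡⟨ ℙ.+-assoc (parity m) (parity n) (parity n) ⟨
  parity m ℙ.+ parity n ℙ.+ parity n    ∎)

parity-2* : ∀ k → parity (2 * k) ≡ 0ℙ
parity-2* k = ℙ.*-homo-* 2 k

parity-+-2* : ∀ m k → parity (m + 2 * k) ≡ parity m
parity-+-2* m k = begin
  parity (m + 2 * k)           ≡⟨ ℙ.+-homo-+ m (2 * k) ⟩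
  parity m ℙ.+ parity (2 * k)  ≡⟨ cong (parity m ℙ.+_) (parity-2* k) ⟩
  parity m ℙ.+ 0ℙ              ≡⟨ ℙ.+-identityʳ (parity m) ⟩
  parity m                     ∎

parity-suc-cong : ∀ m n → parity m ≡ parity n → parity (suc m) ≡ parity (suc n)
parity-suc-cong m n eq = begin
  parity (suc m)         ≡⟨ ℙ.+-homo-+ 1 m ⟩
  parity 1 ℙ.+ parity m  ≡⟨ cong (parity 1 ℙ.+_) eq ⟩
  parity 1 ℙ.+ parity n  ≡⟨ ℙ.+-homo-+ 1 n ⟨
  parity (suc n)         ∎

parity-sum-map-cong : ∀ {A : Set} {f g : A → ℕ} → (∀ x → parity (f x) ≡ parity (g x)) →
                      ∀ xs → parity (sum (map f xs)) ≡ parity (sum (map g xs))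
parity-sum-map-cong             f~g []       = refl
parity-sum-map-cong {f = f} {g} f~g (x ∷ xs) = begin
  parity (f x + sum (map f xs))             ≡⟨ ℙ.+-homo-+ (f x) _ ⟩
  parity (f x) ℙ.+ parity (sum (map f xs))  ≡⟨ cong (ℙ._+ _) (f~g x) ⟩
  parity (g x) ℙ.+ parity (sum (map f xs))  ≡⟨ cong (parity (g x) ℙ.+_) (parity-sum-map-cong f~g xs) ⟩
  parity (g x) ℙ.+ parity (sum (map g xs))  ≡⟨ ℙ.+-homo-+ (g x) _ ⟨
  parity (g x + sum (map g xs))             ∎

evenIndicator : ℕ → ℕ
evenIndicator zero          = 1
evenIndicator (suc zero)    = 0
evenIndicator (suc (suc k)) = evenIndicator k

countEven : List ℕ → ℕ
countEven = sum ∘ map evenIndicator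

parity-evenIndicator : ∀ k → parity (evenIndicator k) ≡ parity (suc k)
parity-evenIndicator zero          = refl
parity-evenIndicator (suc zero)    = refl
parity-evenIndicator (suc (suc k)) = parity-evenIndicator k

sum-map-suc : ∀ xs → sum (map suc xs) ≡ length xs + sum xs
sum-map-suc []       = refl
sum-map-suc (x ∷ xs) = cong suc (begin
  x + sum (map suc xs)      ≡⟨ cong (x +_) (sum-map-suc xs) ⟩
  x + (length xs + sum xs)  ≡⟨ +-assoc x (length xs) (sum xs) ⟨
  x + length xs + sum xs    ≡⟨ cong (_+ sum xs) (+-comm x (length xs)) ⟩
  length xs + x + sum xs    ≡⟨ +-assoc (length xs) x (sum xs) ⟩
  length xs + (x + sum xs)  ∎)

parity-countEven : ∀ xs → parity (countEven xs) ≡ parity (length xs + sum xs)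
parity-countEven xs =
  trans (parity-sum-map-cong parity-evenIndicator xs) (cong parity (sum-map-suc xs))

parity-absDiff : ∀ u w → parity (absDiff u w) ≡ parity (u + w)
parity-absDiff zero    zero    = refl
parity-absDiff zero    (suc w) = refl
parity-absDiff (suc u) zero    = refl
parity-absDiff (suc u) (suc w) = trans (parity-absDiff u w) (cong (parity ∘ suc) (sym (+-suc u w)))

absDiff-< : ∀ {u w v} → u < v → w < v → absDiff u w < v
absDiff-< {zero}  {zero}      _   w<v = w<v
absDiff-< {zero}  {suc w}     _   w<v = w<v
absDiff-< {suc u} {zero}  {v} u<v _   = subst (_< v) (sym (+-identityʳ (suc u))) u<v
absDiff-< {suc u} {suc w}     u<v w<v = absDiff-< (<⇒≤ u<v) (<⇒≤ w<v)

parity-⊓-∸ : ∀ {d v} → parity v ≡ 0ℙ → d ≤ v → parity (d ⊓ (v ∸ d)) ≡ parity d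
parity-⊓-∸ {d} {v} v-even d≤v with ⊓-sel d (v ∸ d)
... | inj₁ eq = cong parity eq
... | inj₂ eq = begin
  parity (d ⊓ (v ∸ d))   ≡⟨ cong parity eq ⟩
  parity (v ∸ d)         ≡⟨ parity-∸ d≤v ⟩
  parity v ℙ.+ parity d  ≡⟨ cong (ℙ._+ parity d) v-even ⟩
  parity d               ∎

endpointSum : ∀ {v} → Edge v → ℕ
endpointSum (u , w) = toℕ u + toℕ w

parity-edgeLength : ∀ {v} → parity v ≡ 0ℙ → (e : Edge v) →
                    parity (edgeLength v e) ≡ parity (endpointSum e)
parity-edgeLength v-even (u , w) =
  trans (parity-⊓-∸ v-even (<⇒≤ (absDiff-< (toℕ<n u) (toℕ<n w)))) (parity-absDiff (toℕ u) (toℕ w))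

sum-upTo-suc : ∀ k → sum (upTo (suc k)) ≡ sum (upTo k) + k
sum-upTo-suc k = begin
  sum (upTo (suc k))      ≡⟨ cong sum (upTo-∷ʳ k) ⟨
  sum (upTo k ∷ʳ k)       ≡⟨ sum-++ (upTo k) (k ∷ []) ⟩
  sum (upTo k) + (k + 0)  ≡⟨ cong (sum (upTo k) +_) (+-identityʳ k) ⟩
  sum (upTo k) + k        ∎

sum-upTo-suc-suc : ∀ m → sum (upTo (suc (suc m))) ≡ suc (sum (upTo m)) + 2 * m
sum-upTo-suc-suc m = begin
  sum (upTo (suc (suc m)))    ≡⟨ sum-upTo-suc (suc m) ⟩
  sum (upTo (suc m)) + suc m  ≡⟨ cong (_+ suc m) (sum-upTo-suc m) ⟩
  S + m + suc m               ≡⟨ +-suc (S + m) m ⟩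
  suc (S + m + m)             ≡⟨ cong suc (+-assoc S m m) ⟩
  suc (S + (m + m))           ≡⟨ cong (λ k → suc (S + (m + k))) (+-identityʳ m) ⟨
  suc S + 2 * m               ∎
  where S = sum (upTo m)

parity-sum-upTo-2* : ∀ n → parity (sum (upTo (2 * n))) ≡ parity n
parity-sum-upTo-2* zero    = refl
parity-sum-upTo-2* (suc n) = begin
  parity (sum (upTo (2 * suc n)))  ≡⟨ cong (parity ∘ sum ∘ upTo) (*-suc 2 n) ⟩
  parity (sum (upTo (2 + 2 * n)))  ≡⟨ cong parity (sum-upTo-suc-suc (2 * n)) ⟩
  parity (suc S + 2 * (2 * n))     ≡⟨ parity-+-2* (suc S) (2 * n) ⟩
  parity (suc S)                   ≡⟨ parity-suc-cong S n (parity-sum-upTo-2* n) ⟩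
  parity (suc n)                   ∎
  where S = sum (upTo (2 * n))

tabulate-∘-toℕ : ∀ {A : Set} n (f : ℕ → A) → tabulate {n = n} (f ∘ toℕ) ≡ applyUpTo f n
tabulate-∘-toℕ zero    f = refl
tabulate-∘-toℕ (suc n) f = cong (f 0 ∷_) (tabulate-∘-toℕ n (f ∘ suc))

map-toℕ-allFin : ∀ n → map toℕ (allFin n) ≡ upTo n
map-toℕ-allFin n = trans (map-tabulate id toℕ) (tabulate-∘-toℕ n id)

length-endpoints : ∀ {v} (F : List (Edge v)) → length (endpoints F) ≡ 2 * length F
length-endpoints []      = refl
length-endpoints (e ∷ F) =
  trans (cong (suc ∘ suc) (length-endpoints F)) (sym (*-suc 2 (length F)))

sum-endpoints : ∀ {v} (F : List (Edge v)) → sum (map toℕ (endpoints F)) ≡ sum (map endpointSum F)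
sum-endpoints []            = refl
sum-endpoints ((u , w) ∷ F) =
  trans (sym (+-assoc (toℕ u) (toℕ w) _)) (cong (endpointSum (u , w) +_) (sum-endpoints F))

length-perfectMatching : ∀ n F → IsPerfectMatching n F → length F ≡ n
length-perfectMatching n F pm = *-cancelˡ-≡ (length F) n 2 (begin
  2 * length F             ≡⟨ length-endpoints F ⟨
  length (endpoints F)     ≡⟨ ↭-length pm ⟩
  length (allFin (2 * n))  ≡⟨ length-tabulate id ⟩
  2 * n                    ∎)

parity-sum-lengths : ∀ n F → IsPerfectMatching n F → parity (sum (lengths (2 * n) F)) ≡ parity n
parity-sum-lengths n F pm = begin
  parity (sum (map (edgeLength (2 * n)) F))
    ≡⟨ parity-sum-map-cong (parity-edgeLength (parity-2* n)) F ⟩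
  parity (sum (map endpointSum F))          ≡⟨ cong parity (sum-endpoints F) ⟨
  parity (sum (map toℕ (endpoints F)))      ≡⟨ cong parity (sum-↭ (map⁺ toℕ pm)) ⟩
  parity (sum (map toℕ (allFin (2 * n))))   ≡⟨ cong (parity ∘ sum) (map-toℕ-allFin (2 * n)) ⟩
  parity (sum (upTo (2 * n)))               ≡⟨ parity-sum-upTo-2* n ⟩
  parity n                                  ∎

parity-countEven-lengths : ∀ n F → IsPerfectMatching n F → parity (countEven (lengths (2 * n) F)) ≡ 0ℙ
parity-countEven-lengths n F pm = begin
  parity (countEven L)                  ≡⟨ parity-countEven L ⟩
  parity (length L + sum L)             ≡⟨ ℙ.+-homo-+ (length L) (sum L) ⟩
  parity (length L) ℙ.+ parity (sum L)  ≡⟨ cong₂ ℙ._+_ (cong parity length-L) (parity-sum-lengths n F pm) ⟩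
  parity n ℙ.+ parity n                 ≡⟨ ℙ.p+p≡0ℙ (parity n) ⟩
  0ℙ                                    ∎
  where
  L = lengths (2 * n) F
  length-L : length L ≡ n
  length-L = trans (length-map (edgeLength (2 * n)) F) (length-perfectMatching n F pm)

sum-map-replicate : ∀ (g : ℕ → ℕ) k i → sum (map g (replicate k i)) ≡ k * g i
sum-map-replicate g zero    i = refl
sum-map-replicate g (suc k) i = cong (g i +_) (sum-map-replicate g k i)

sum-map-concatMap-replicate : ∀ (g a : ℕ → ℕ) xs →
  sum (map g (concatMap (λ i → replicate (a i) i) xs)) ≡ sum (map (λ i → a i * g i) xs)
sum-map-concatMap-replicate g a []       = refl
sum-map-concatMap-replicate g a (x ∷ xs) = begin
  sum (map g (replicate (a x) x ++ rest))        ≡⟨ cong sum (map-++ g (replicate (a x) x) rest) ⟩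
  sum (map g (replicate (a x) x) ++ map g rest)  ≡⟨ sum-++ (map g (replicate (a x) x)) (map g rest) ⟩
  sum (map g (replicate (a x) x)) + sum (map g rest)
    ≡⟨ cong₂ _+_ (sum-map-replicate g (a x) x) (sum-map-concatMap-replicate g a xs) ⟩
  a x * g x + sum (map (λ i → a i * g i) xs)     ∎
  where rest = concatMap (λ i → replicate (a i) i) xs

applyUpTo-cong : ∀ {A : Set} {f g : ℕ → A} → (∀ i → f i ≡ g i) → ∀ n → applyUpTo f n ≡ applyUpTo g n
applyUpTo-cong f≗g zero    = refl
applyUpTo-cong f≗g (suc n) = cong₂ _∷_ (f≗g 0) (applyUpTo-cong (f≗g ∘ suc) n)

sum-applyUpTo-evenIndicator : ∀ (f : ℕ → ℕ) n →
  sum (applyUpTo (λ i → f (suc i) * evenIndicator (suc i)) n) ≡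
  sum (applyUpTo (λ i → f (2 * suc i)) (n / 2))
sum-applyUpTo-evenIndicator f zero          = refl
sum-applyUpTo-evenIndicator f (suc zero)    = trans (+-identityʳ (f 1 * 0)) (*-zeroʳ (f 1))
sum-applyUpTo-evenIndicator f (suc (suc m)) = begin
  f 1 * 0 + (f 2 * 1 + S)
    ≡⟨ cong₂ _+_ (*-zeroʳ (f 1)) (cong (_+ S) (*-identityʳ (f 2))) ⟩
  f 2 + S
    ≡⟨ cong (f 2 +_) (sum-applyUpTo-evenIndicator (f ∘ suc ∘ suc) m) ⟩
  f 2 + sum (applyUpTo (λ i → f (2 + 2 * suc i)) (m / 2))
    ≡⟨ cong (λ xs → f 2 + sum xs) (applyUpTo-cong (λ i → cong f (*-suc 2 (suc i))) (m / 2)) ⟨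
  sum (applyUpTo g (suc (m / 2)))
    ≡⟨ cong (sum ∘ applyUpTo g) (m/n≡1+[m∸n]/n {suc (suc m)} (s≤s (s≤s z≤n))) ⟨
  sum (applyUpTo g (suc (suc m) / 2))
    ∎
  where
  S = sum (applyUpTo (λ i → f (suc (suc (suc i))) * evenIndicator (suc i)) m)
  g = λ i → f (2 * suc i)

countEven-lengthList : ∀ n a → countEven (lengthList n a) ≡ evenIndexSum n a
countEven-lengthList n a = begin
  sum (map evenIndicator (concatMap (λ i → replicate (a i) i) (applyUpTo suc n)))
    ≡⟨ sum-map-concatMap-replicate evenIndicator a (applyUpTo suc n) ⟩
  sum (map (λ i → a i * evenIndicator i) (applyUpTo suc n))
    ≡⟨ cong sum (map-applyUpTo suc (λ i → a i * evenIndicator i) n) ⟩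
  sum (applyUpTo (λ i → a (suc i) * evenIndicator (suc i)) n)
    ≡⟨ sum-applyUpTo-evenIndicator a n ⟩
  sum (applyUpTo (λ i → a (2 * suc i)) (n / 2))
    ≡⟨ cong sum (map-applyUpTo suc (λ i → a (2 * i)) (n / 2)) ⟨
  evenIndexSum n a
    ∎

proposition2p4 : (n : ℕ) → 0 < n → (a : ℕ → ℕ) →
    Σ (List (Edge (2 * n))) (λ F → IsPerfectMatching n F × (lengths (2 * n) F ↭ lengthList n a)) →
    2 ∣ evenIndexSum n a
proposition2p4 n _ a (F , pm , ℓF↭L) = parity≡0ℙ⇒2∣ (evenIndexSum n a) (begin
  parity (evenIndexSum n a)               ≡⟨ cong parity (countEven-lengthList n a) ⟨
  parity (countEven (lengthList n a))     ≡⟨ cong parity (sum-↭ (map⁺ evenIndicator ℓF↭L)) ⟨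
  parity (countEven (lengths (2 * n) F))  ≡⟨ parity-countEven-lengths n F pm ⟩
  0ℙ                                      ∎)
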